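{- For every kind $\Phi$ (i.e. $\Phi:\square$) and every type constructor $\varphi:\Phi$, we have $\varphi\in\mathrm{Red}_\Phi$.
   Context: Terms: $t,s::= x\mid o\mid ot\mid o\nu\mid (ot)\nu\mid \lambda x:\varphi.t\mid ts\mid t\oplus_p s\mid t\nu\mid \langle t,s\rangle\mid t\pi_j\mid [\kappa]\mid [t,[\kappa_1/\dots/\kappa_n],s]$. Type constructors: $\varphi::=\alpha\mid \lambda x:\varphi_1.\varphi_2\mid \varphi t\mid \forall x:\varphi_1.\varphi_2\mid \oplus\varphi\mid\Sigma\varphi\mid \varphi_1\wedge\varphi_2$. Kinds: $\Phi::=*\mid\Pi x:\varphi.\Phi$. $\Phi:\square$, $\varphi:\Phi$, $t:A$ denote derivability in the paper's dependent type system: $\vdash *:\square$; $\Pi x:A.\Phi:\square$ if $\Phi:\square$ under $x:A$; a declared $\alpha:\Phi$ has kind $\Phi$; $\forall x:A.B:*$ if $B:*$ under $x:A$; $\oplus A,\Sigma A:*$ if $A:*$; $A\wedge B:*$ if $A,B:*$; $\lambda x:A.\varphi:\Pi x:A.\Phi$ if $\varphi:\Phi$ under $x:A$; $\varphi t:\Phi[t/x]$ if $\varphi:\Pi x:A.\Phi$ and $t:A$; weakening; conversion modulo $\beta$ (plus the term typing rules). The reduction $\varphi\mapsto\varphi'$ on type constructors replaces a subexpression $(\lambda x:\varphi_1.\varphi_2)t$ by $\varphi_2[t/x]$; strongly normalising means no infinite reduction sequence. Reducibles of a kind: $\mathrm{Red}_*$ is the set of strongly normalising type constructors of kind $*$;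 $\mathrm{Red}_{\Pi x:B.\Psi}$ is the set of $\varphi:\Pi x:B.\Psi$ such that $\varphi s\in\mathrm{Red}_{\Psi[s/x]}$ for every term $s:B$. -}

module Defs where

open import Data.Nat using (ℕ; zero; suc)
open import Data.Fin using (Fin)
open import Data.List using (List; []; _∷_)
open import Data.Product using (Σ; _×_; _,_)
open import Data.Unit using (⊤)
open import Data.Empty using (⊥)
open import Relation.Nullary using (¬_)
open import Relation.Binary.PropositionalEquality using (_≡_; _≢_)
open import Relation.Binary.Construct.Closure.Equivalence using (EqClosure)

-- The syntax is parametrised by the (unspecified) sets of atomic labels:
--   O  : constants  o
--   N  : labels     ν
--   Pr : indices    p   of  t ⊕_p s
--   K  : labels     κ
-- Term variables x are de Bruijn indices (ℕ); they are bound by the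
-- term λ, the type-constructor λ, ∀ and Π.  Type-constructor variables
-- α are names (ℕ), declared in the context.

module System (O N Pr K : Set) where

  mutual
    data Tm : Set where
      var     : ℕ → Tm
      oc      : O → Tm
      ocApp   : O → Tm → Tm
      ocNu    : O → N → Tm
      ocAppNu : O → Tm → N → Tm
      lam     : Ty → Tm → Tm
      app     : Tm → Tm → Tm
      choice  : Tm → Pr → Tm → Tm
      nuApp   : Tm → N → Tm
      pair    : Tm → Tm → Tm
      proj    : Tm → Fin 2 → Tm           -- t π_j   (j ∈ {1,2})
      box     : K → Tm
      case    : Tm → List K → Tm → Tm

    data Ty : Set where
      tvar   : ℕ → Ty
      tlam   : Ty → Ty → Ty
      tapp   : Ty → Tm → Ty
      tall   : Ty → Ty → Ty
      toplus : Ty → Ty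
      tsigma : Ty → Ty
      tand   : Ty → Ty → Ty

  data Kind : Set where
    ⋆  : Kind
    Π  : Ty → Kind → Kind

  ext : (ℕ → ℕ) → ℕ → ℕ
  ext ρ zero    = zero
  ext ρ (suc n) = suc (ρ n)

  mutual
    renTm : (ℕ → ℕ) → Tm → Tm
    renTm ρ (var n)           = var (ρ n)
    renTm ρ (oc o)            = oc o
    renTm ρ (ocApp o t)       = ocApp o (renTm ρ t)
    renTm ρ (ocNu o ν)        = ocNu o ν
    renTm ρ (ocAppNu o t ν)   = ocAppNu o (renTm ρ t) ν
    renTm ρ (lam A t)         = lam (renTy ρ A) (renTm (ext ρ) t)
    renTm ρ (app t s)         = app (renTm ρ t) (renTm ρ s)
    renTm ρ (choice t p s)    = choice (renTm ρ t) p (renTm ρ s)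
    renTm ρ (nuApp t ν)       = nuApp (renTm ρ t) ν
    renTm ρ (pair t s)        = pair (renTm ρ t) (renTm ρ s)
    renTm ρ (proj t j)        = proj (renTm ρ t) j
    renTm ρ (box κ)           = box κ
    renTm ρ (case t κs s)     = case (renTm ρ t) κs (renTm ρ s)

    renTy : (ℕ → ℕ) → Ty → Ty
    renTy ρ (tvar α)     = tvar α
    renTy ρ (tlam A φ)   = tlam (renTy ρ A) (renTy (ext ρ) φ)
    renTy ρ (tapp φ t)   = tapp (renTy ρ φ) (renTm ρ t)
    renTy ρ (tall A B)   = tall (renTy ρ A) (renTy (ext ρ) B)
    renTy ρ (toplus A)   = toplus (renTy ρ A)
    renTy ρ (tsigma A)   = tsigma (renTy ρ A)
    renTy ρ (tand A B)   = tand (renTy ρ A) (renTy ρ B)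

  renK : (ℕ → ℕ) → Kind → Kind
  renK ρ ⋆       = ⋆
  renK ρ (Π A Φ) = Π (renTy ρ A) (renK (ext ρ) Φ)

  exts : (ℕ → Tm) → ℕ → Tm
  exts σ zero    = var zero
  exts σ (suc n) = renTm suc (σ n)

  mutual
    subTm : (ℕ → Tm) → Tm → Tm
    subTm σ (var n)           = σ n
    subTm σ (oc o)            = oc o
    subTm σ (ocApp o t)       = ocApp o (subTm σ t)
    subTm σ (ocNu o ν)        = ocNu o ν
    subTm σ (ocAppNu o t ν)   = ocAppNu o (subTm σ t) ν
    subTm σ (lam A t)         = lam (subTy σ A) (subTm (exts σ) t)
    subTm σ (app t s)         = app (subTm σ t) (subTm σ s)
    subTm σ (choice t p s)    = choice (subTm σ t) p (subTm σ s)
    subTm σ (nuApp t ν)       = nuApp (subTm σ t) ν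
    subTm σ (pair t s)        = pair (subTm σ t) (subTm σ s)
    subTm σ (proj t j)        = proj (subTm σ t) j
    subTm σ (box κ)           = box κ
    subTm σ (case t κs s)     = case (subTm σ t) κs (subTm σ s)

    subTy : (ℕ → Tm) → Ty → Ty
    subTy σ (tvar α)     = tvar α
    subTy σ (tlam A φ)   = tlam (subTy σ A) (subTy (exts σ) φ)
    subTy σ (tapp φ t)   = tapp (subTy σ φ) (subTm σ t)
    subTy σ (tall A B)   = tall (subTy σ A) (subTy (exts σ) B)
    subTy σ (toplus A)   = toplus (subTy σ A)
    subTy σ (tsigma A)   = tsigma (subTy σ A)
    subTy σ (tand A B)   = tand (subTy σ A) (subTy σ B)

  subK : (ℕ → Tm) → Kind → Kind
  subK σ ⋆       = ⋆
  subK σ (Π A Φ) = Π (subTy σ A) (subK (exts σ) Φ)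

  single : Tm → ℕ → Tm
  single t zero    = t
  single t (suc n) = var n

  _[_]Ty : Ty → Tm → Ty
  φ [ t ]Ty = subTy (single t) φ

  _[_]K : Kind → Tm → Kind
  Φ [ t ]K = subK (single t) Φ

  shTy : Ty → Ty
  shTy = renTy suc

  shK : Kind → Kind
  shK = renK suc

  infix 4 _↦t_ _↦_ _↦K_

  mutual
    data _↦t_ : Tm → Tm → Set where
      ocApp-c   : ∀ {o t t'} → t ↦t t' → ocApp o t ↦t ocApp o t'
      ocAppNu-c : ∀ {o t t' ν} → t ↦t t' → ocAppNu o t ν ↦t ocAppNu o t' ν
      lam₁      : ∀ {A A' t} → A ↦ A' → lam A t ↦t lam A' t
      lam₂      : ∀ {A t t'} → t ↦t t' → lam A t ↦t lam A t'
      app₁      : ∀ {t t' s} → t ↦t t' → app t s ↦t app t' s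
      app₂      : ∀ {t s s'} → s ↦t s' → app t s ↦t app t s'
      choice₁   : ∀ {t t' p s} → t ↦t t' → choice t p s ↦t choice t' p s
      choice₂   : ∀ {t p s s'} → s ↦t s' → choice t p s ↦t choice t p s'
      nuApp-c   : ∀ {t t' ν} → t ↦t t' → nuApp t ν ↦t nuApp t' ν
      pair₁     : ∀ {t t' s} → t ↦t t' → pair t s ↦t pair t' s
      pair₂     : ∀ {t s s'} → s ↦t s' → pair t s ↦t pair t s'
      proj-c    : ∀ {t t' j} → t ↦t t' → proj t j ↦t proj t' j
      case₁     : ∀ {t t' κs s} → t ↦t t' → case t κs s ↦t case t' κs s
      case₂     : ∀ {t κs s s'} → s ↦t s' → case t κs s ↦t case t κs s'

    data _↦_ : Ty → Ty → Set where
      β       : ∀ {A φ t} → tapp (tlam A φ) t ↦ φ [ t ]Ty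
      tlam₁   : ∀ {A A' φ} → A ↦ A' → tlam A φ ↦ tlam A' φ
      tlam₂   : ∀ {A φ φ'} → φ ↦ φ' → tlam A φ ↦ tlam A φ'
      tapp₁   : ∀ {φ φ' t} → φ ↦ φ' → tapp φ t ↦ tapp φ' t
      tapp₂   : ∀ {φ t t'} → t ↦t t' → tapp φ t ↦ tapp φ t'
      tall₁   : ∀ {A A' B} → A ↦ A' → tall A B ↦ tall A' B
      tall₂   : ∀ {A B B'} → B ↦ B' → tall A B ↦ tall A B'
      toplus-c : ∀ {A A'} → A ↦ A' → toplus A ↦ toplus A'
      tsigma-c : ∀ {A A'} → A ↦ A' → tsigma A ↦ tsigma A'
      tand₁   : ∀ {A A' B} → A ↦ A' → tand A B ↦ tand A' B
      tand₂   : ∀ {A B B'} → B ↦ B' → tand A B ↦ tand A B'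

  data _↦K_ : Kind → Kind → Set where
    Π₁ : ∀ {A A' Φ} → A ↦ A' → Π A Φ ↦K Π A' Φ
    Π₂ : ∀ {A Φ Φ'} → Φ ↦K Φ' → Π A Φ ↦K Π A Φ'

  _=βK_ : Kind → Kind → Set
  _=βK_ = EqClosure _↦K_

  SN : Ty → Set
  SN φ = ¬ (Σ (ℕ → Ty) λ f → f zero ≡ φ × (∀ n → f n ↦ f (suc n)))

  data Entry : Set where
    tmDecl : Ty → Entry
    tyDecl : ℕ → Kind → Entry

  Ctx : Set
  Ctx = List Entry          -- head = most recent declaration

  Fresh : ℕ → Ctx → Set
  Fresh α []                = ⊤
  Fresh α (tmDecl _ ∷ Γ)    = Fresh α Γ
  Fresh α (tyDecl α₀ _ ∷ Γ) = α ≢ α₀ × Fresh α Γ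

  -- Kinding, parametrised by the term typing judgment  Γ ⊢ t : A
  -- (whose rules are not part of the given context).

  module Typing (_⊢t_∶_ : Ctx → Tm → Ty → Set) where

    infix 3 _⊢K_ _⊢_∶_

    mutual
      data _⊢K_ : Ctx → Kind → Set where
        ax     : [] ⊢K ⋆
        Π-form : ∀ {Γ A Φ} → (tmDecl A ∷ Γ) ⊢K Φ → Γ ⊢K Π A Φ
        wkK-tm : ∀ {Γ Φ A} → Γ ⊢K Φ → Γ ⊢ A ∶ ⋆ → (tmDecl A ∷ Γ) ⊢K shK Φ
        wkK-ty : ∀ {Γ Φ α Ψ} → Γ ⊢K Φ → Γ ⊢K Ψ → Fresh α Γ →
                 (tyDecl α Ψ ∷ Γ) ⊢K Φ

      data _⊢_∶_ : Ctx → Ty → Kind → Set where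
        start   : ∀ {Γ α Φ} → Γ ⊢K Φ → Fresh α Γ → (tyDecl α Φ ∷ Γ) ⊢ tvar α ∶ Φ
        ∀-form  : ∀ {Γ A B} → (tmDecl A ∷ Γ) ⊢ B ∶ ⋆ → Γ ⊢ tall A B ∶ ⋆
        ⊕-form  : ∀ {Γ A} → Γ ⊢ A ∶ ⋆ → Γ ⊢ toplus A ∶ ⋆
        Σ-form  : ∀ {Γ A} → Γ ⊢ A ∶ ⋆ → Γ ⊢ tsigma A ∶ ⋆
        ∧-form  : ∀ {Γ A B} → Γ ⊢ A ∶ ⋆ → Γ ⊢ B ∶ ⋆ → Γ ⊢ tand A B ∶ ⋆
        λ-intro : ∀ {Γ A φ Φ} → (tmDecl A ∷ Γ) ⊢ φ ∶ Φ → Γ ⊢ tlam A φ ∶ Π A Φ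
        app     : ∀ {Γ φ A Φ t} → Γ ⊢ φ ∶ Π A Φ → Γ ⊢t t ∶ A → Γ ⊢ tapp φ t ∶ Φ [ t ]K
        wk-tm   : ∀ {Γ φ Φ A} → Γ ⊢ φ ∶ Φ → Γ ⊢ A ∶ ⋆ →
                  (tmDecl A ∷ Γ) ⊢ shTy φ ∶ shK Φ
        wk-ty   : ∀ {Γ φ Φ α Ψ} → Γ ⊢ φ ∶ Φ → Γ ⊢K Ψ → Fresh α Γ →
                  (tyDecl α Ψ ∷ Γ) ⊢ φ ∶ Φ
        conv    : ∀ {Γ φ Φ Ψ} → Γ ⊢ φ ∶ Φ → Φ =βK Ψ → Γ ⊢K Ψ → Γ ⊢ φ ∶ Ψ

    -- Reducibles.  Red_Φ is defined by recursion on the number of Π's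
    -- in Φ (substitution Ψ[s/x] does not change it); 'depth' is that
    -- number, used as the recursion measure.

    depth : Kind → ℕ
    depth ⋆       = zero
    depth (Π _ Φ) = suc (depth Φ)

    RedAt : ℕ → Ctx → Kind → Ty → Set
    RedAt zero    Γ ⋆       φ = Γ ⊢ φ ∶ ⋆ × SN φ
    RedAt (suc n) Γ (Π B Ψ) φ =
      Γ ⊢ φ ∶ Π B Ψ × (∀ s → Γ ⊢t s ∶ B → RedAt n Γ (Ψ [ s ]K) (tapp φ s))
    RedAt _       _ _       _ = ⊥

    Red : Ctx → Kind → Ty → Set
    Red Γ Φ φ = RedAt (depth Φ) Γ Φ φ

{-# OPTIONS --safe #-}
module Submission where

-- Type constructors are applied only to terms, and terms have no β-rule of their
-- own, so in Tait's method an argument need only be strongly normalising, and reducibility of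
-- a type constructor can be indexed by the number of arguments it still expects instead of by
-- its kind.  Every type constructor, under any substitution of such terms, is reducible at
-- every arity.  Red then follows by induction on the number of Π's in the kind, using only the
-- application rule.

open import Defs
open import Data.Nat using (ℕ; zero; suc)
open import Data.Nat.Properties using (suc-injective)
open import Data.Product using (Σ; ∃-syntax; _×_; _,_; proj₁; proj₂)
open import Data.Sum using (_⊎_; inj₁; inj₂)
open import Data.Unit using (⊤; tt)
open import Data.Empty using (⊥)
open import Function using (_∘_; flip; id)
open import Induction.WellFounded using (Acc; acc; acc-inverse)
open import Induction.InfiniteDescent
  using (InfiniteDescendingSequenceFrom; descent∧acc⇒unsatisfiable)
open import Relation.Binary.Rewriting using (StronglyNormalizing)
open import Relation.Binary.PropositionalEquality
  using (_≡_; _≗_; refl; sym; trans; cong; cong₂; subst; subst₂; module ≡-Reasoning)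

module _ {A C : Set} {_⟶ᴬ_ : A → A → Set} {_⟶ᶜ_ : C → C → Set} where

  acc-cong : (f : A → C) →
             (∀ {x z} → f x ⟶ᶜ z → ∃[ x₁ ] x ⟶ᴬ x₁ × z ≡ f x₁) →
             ∀ {x} → Acc (flip _⟶ᴬ_) x → Acc (flip _⟶ᶜ_) (f x)
  acc-cong f inv {x} (acc hx) = acc λ r → reduct (inv r)
    where
    reduct : ∀ {z} → ∃[ x₁ ] x ⟶ᴬ x₁ × z ≡ f x₁ → Acc (flip _⟶ᶜ_) z
    reduct (_ , r , refl) = acc-cong f inv (hx r)

module _ {A B C : Set} {_⟶ᴬ_ : A → A → Set} {_⟶ᴮ_ : B → B → Set} {_⟶ᶜ_ : C → C → Set} where

  acc-cong₂ : (f : A → B → C) →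
              (∀ {x y z} → f x y ⟶ᶜ z →
                (∃[ x₁ ] x ⟶ᴬ x₁ × z ≡ f x₁ y) ⊎ (∃[ y₁ ] y ⟶ᴮ y₁ × z ≡ f x y₁)) →
              ∀ {x y} → Acc (flip _⟶ᴬ_) x → Acc (flip _⟶ᴮ_) y → Acc (flip _⟶ᶜ_) (f x y)
  acc-cong₂ f inv {x} {y} ax@(acc hx) ay@(acc hy) = acc λ r → reduct (inv r)
    where
    reduct : ∀ {z} → (∃[ x₁ ] x ⟶ᴬ x₁ × z ≡ f x₁ y) ⊎ (∃[ y₁ ] y ⟶ᴮ y₁ × z ≡ f x y₁) →
             Acc (flip _⟶ᶜ_) z
    reduct (inj₁ (_ , r , refl)) = acc-cong₂ f inv (hx r) ay
    reduct (inj₂ (_ , r , refl)) = acc-cong₂ f inv ax (hy r)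

module Substitution (O N Pr K : Set) where
  open System O N Pr K
  open ≡-Reasoning

  exts-var : ∀ {ρ σ} → σ ≗ var ∘ ρ → exts σ ≗ var ∘ ext ρ
  exts-var h zero    = refl
  exts-var h (suc n) = cong (renTm suc) (h n)

  mutual
    renTm-as-subTm : ∀ {ρ σ} → σ ≗ var ∘ ρ → ∀ t → renTm ρ t ≡ subTm σ t
    renTm-as-subTm h (var n)         = sym (h n)
    renTm-as-subTm h (oc o)          = refl
    renTm-as-subTm h (ocApp o t)     = cong (ocApp o) (renTm-as-subTm h t)
    renTm-as-subTm h (ocNu o ν)      = refl
    renTm-as-subTm h (ocAppNu o t ν) = cong (λ a → ocAppNu o a ν) (renTm-as-subTm h t)
    renTm-as-subTm h (lam A t)       = cong₂ lam (renTy-as-subTy h A) (renTm-as-subTm (exts-var h) t)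
    renTm-as-subTm h (app t s)       = cong₂ app (renTm-as-subTm h t) (renTm-as-subTm h s)
    renTm-as-subTm h (choice t p s)  = cong₂ (λ a b → choice a p b) (renTm-as-subTm h t) (renTm-as-subTm h s)
    renTm-as-subTm h (nuApp t ν)     = cong (λ a → nuApp a ν) (renTm-as-subTm h t)
    renTm-as-subTm h (pair t s)      = cong₂ pair (renTm-as-subTm h t) (renTm-as-subTm h s)
    renTm-as-subTm h (proj t j)      = cong (λ a → proj a j) (renTm-as-subTm h t)
    renTm-as-subTm h (box κ)         = refl
    renTm-as-subTm h (case t κs s)   = cong₂ (λ a b → case a κs b) (renTm-as-subTm h t) (renTm-as-subTm h s)

    renTy-as-subTy : ∀ {ρ σ} → σ ≗ var ∘ ρ → ∀ φ → renTy ρ φ ≡ subTy σ φ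
    renTy-as-subTy h (tvar α)   = refl
    renTy-as-subTy h (tlam A φ) = cong₂ tlam (renTy-as-subTy h A) (renTy-as-subTy (exts-var h) φ)
    renTy-as-subTy h (tapp φ t) = cong₂ tapp (renTy-as-subTy h φ) (renTm-as-subTm h t)
    renTy-as-subTy h (tall A B) = cong₂ tall (renTy-as-subTy h A) (renTy-as-subTy (exts-var h) B)
    renTy-as-subTy h (toplus A) = cong toplus (renTy-as-subTy h A)
    renTy-as-subTy h (tsigma A) = cong tsigma (renTy-as-subTy h A)
    renTy-as-subTy h (tand A B) = cong₂ tand (renTy-as-subTy h A) (renTy-as-subTy h B)

  exts-id : ∀ {σ} → σ ≗ var → exts σ ≗ var
  exts-id h zero    = refl
  exts-id h (suc n) = cong (renTm suc) (h n)

  mutual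
    subTm-id : ∀ {σ} → σ ≗ var → ∀ t → subTm σ t ≡ t
    subTm-id h (var n)         = h n
    subTm-id h (oc o)          = refl
    subTm-id h (ocApp o t)     = cong (ocApp o) (subTm-id h t)
    subTm-id h (ocNu o ν)      = refl
    subTm-id h (ocAppNu o t ν) = cong (λ a → ocAppNu o a ν) (subTm-id h t)
    subTm-id h (lam A t)       = cong₂ lam (subTy-id h A) (subTm-id (exts-id h) t)
    subTm-id h (app t s)       = cong₂ app (subTm-id h t) (subTm-id h s)
    subTm-id h (choice t p s)  = cong₂ (λ a b → choice a p b) (subTm-id h t) (subTm-id h s)
    subTm-id h (nuApp t ν)     = cong (λ a → nuApp a ν) (subTm-id h t)
    subTm-id h (pair t s)      = cong₂ pair (subTm-id h t) (subTm-id h s)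
    subTm-id h (proj t j)      = cong (λ a → proj a j) (subTm-id h t)
    subTm-id h (box κ)         = refl
    subTm-id h (case t κs s)   = cong₂ (λ a b → case a κs b) (subTm-id h t) (subTm-id h s)

    subTy-id : ∀ {σ} → σ ≗ var → ∀ φ → subTy σ φ ≡ φ
    subTy-id h (tvar α)   = refl
    subTy-id h (tlam A φ) = cong₂ tlam (subTy-id h A) (subTy-id (exts-id h) φ)
    subTy-id h (tapp φ t) = cong₂ tapp (subTy-id h φ) (subTm-id h t)
    subTy-id h (tall A B) = cong₂ tall (subTy-id h A) (subTy-id (exts-id h) B)
    subTy-id h (toplus A) = cong toplus (subTy-id h A)
    subTy-id h (tsigma A) = cong tsigma (subTy-id h A)
    subTy-id h (tand A B) = cong₂ tand (subTy-id h A) (subTy-id h B)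

  renTm-id : ∀ t → renTm id t ≡ t
  renTm-id t = trans (renTm-as-subTm (λ _ → refl) t) (subTm-id (λ _ → refl) t)

  -- The fusion laws for renaming after substitution, substitution after renaming and
  -- substitution after substitution are instances of this single traversal.
  module Fusion
    (Fuses : (ℕ → Tm) → (ℕ → Tm) → (ℕ → Tm) → Set)
    (fuses-var  : ∀ {σ τ υ} → Fuses σ τ υ → subTm σ ∘ τ ≗ υ)
    (fuses-exts : ∀ {σ τ υ} → Fuses σ τ υ → Fuses (exts σ) (exts τ) (exts υ))
    where

    mutual
      subTm-fusion : ∀ {σ τ υ} → Fuses σ τ υ → ∀ t → subTm σ (subTm τ t) ≡ subTm υ t
      subTm-fusion h (var n)         = fuses-var h n
      subTm-fusion h (oc o)          = refl
      subTm-fusion h (ocApp o t)     = cong (ocApp o) (subTm-fusion h t)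
      subTm-fusion h (ocNu o ν)      = refl
      subTm-fusion h (ocAppNu o t ν) = cong (λ a → ocAppNu o a ν) (subTm-fusion h t)
      subTm-fusion h (lam A t)       = cong₂ lam (subTy-fusion h A) (subTm-fusion (fuses-exts h) t)
      subTm-fusion h (app t s)       = cong₂ app (subTm-fusion h t) (subTm-fusion h s)
      subTm-fusion h (choice t p s)  = cong₂ (λ a b → choice a p b) (subTm-fusion h t) (subTm-fusion h s)
      subTm-fusion h (nuApp t ν)     = cong (λ a → nuApp a ν) (subTm-fusion h t)
      subTm-fusion h (pair t s)      = cong₂ pair (subTm-fusion h t) (subTm-fusion h s)
      subTm-fusion h (proj t j)      = cong (λ a → proj a j) (subTm-fusion h t)
      subTm-fusion h (box κ)         = refl
      subTm-fusion h (case t κs s)   = cong₂ (λ a b → case a κs b) (subTm-fusion h t) (subTm-fusion h s)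

      subTy-fusion : ∀ {σ τ υ} → Fuses σ τ υ → ∀ φ → subTy σ (subTy τ φ) ≡ subTy υ φ
      subTy-fusion h (tvar α)   = refl
      subTy-fusion h (tlam A φ) = cong₂ tlam (subTy-fusion h A) (subTy-fusion (fuses-exts h) φ)
      subTy-fusion h (tapp φ t) = cong₂ tapp (subTy-fusion h φ) (subTm-fusion h t)
      subTy-fusion h (tall A B) = cong₂ tall (subTy-fusion h A) (subTy-fusion (fuses-exts h) B)
      subTy-fusion h (toplus A) = cong toplus (subTy-fusion h A)
      subTy-fusion h (tsigma A) = cong tsigma (subTy-fusion h A)
      subTy-fusion h (tand A B) = cong₂ tand (subTy-fusion h A) (subTy-fusion h B)

  subTm-renTm : ∀ σ ρ t → subTm σ (renTm ρ t) ≡ subTm (σ ∘ ρ) t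
  subTm-renTm σ ρ t = trans (cong (subTm σ) (renTm-as-subTm (λ _ → refl) t))
                            (subTm-fusion (ρ , (λ _ → refl) , (λ _ → refl)) t)
    where
    AfterRenaming : (ℕ → Tm) → (ℕ → Tm) → (ℕ → Tm) → Set
    AfterRenaming σ τ υ = Σ (ℕ → ℕ) λ ρ → τ ≗ var ∘ ρ × σ ∘ ρ ≗ υ

    afterRenaming-var : ∀ {σ τ υ} → AfterRenaming σ τ υ → subTm σ ∘ τ ≗ υ
    afterRenaming-var {σ} (ρ , τ≗ρ , σρ≗υ) n = trans (cong (subTm σ) (τ≗ρ n)) (σρ≗υ n)

    afterRenaming-exts : ∀ {σ τ υ} → AfterRenaming σ τ υ →
                         AfterRenaming (exts σ) (exts τ) (exts υ)
    afterRenaming-exts (ρ , τ≗ρ , σρ≗υ) = ext ρ , exts-var τ≗ρ , λ where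
      zero    → refl
      (suc n) → cong (renTm suc) (σρ≗υ n)

    open Fusion AfterRenaming afterRenaming-var afterRenaming-exts

  renTm-renTm : ∀ {ρ₁ ρ₂ ρ} → ρ₂ ∘ ρ₁ ≗ ρ → ∀ t → renTm ρ₂ (renTm ρ₁ t) ≡ renTm ρ t
  renTm-renTm {ρ₁} {ρ₂} {ρ} h t = begin
    renTm ρ₂ (renTm ρ₁ t)              ≡⟨ renTm-as-subTm (λ _ → refl) (renTm ρ₁ t) ⟩
    subTm (var ∘ ρ₂) (renTm ρ₁ t)      ≡⟨ subTm-renTm (var ∘ ρ₂) ρ₁ t ⟩
    subTm (var ∘ ρ₂ ∘ ρ₁) t            ≡⟨ sym (renTm-as-subTm (cong var ∘ h) t) ⟩
    renTm ρ t                          ∎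

  renTm-subTm : ∀ ρ σ t → renTm ρ (subTm σ t) ≡ subTm (renTm ρ ∘ σ) t
  renTm-subTm ρ σ t = trans (renTm-as-subTm (λ _ → refl) (subTm σ t))
                            (subTm-fusion (ρ , (λ _ → refl) , (λ _ → refl)) t)
    where
    BeforeRenaming : (ℕ → Tm) → (ℕ → Tm) → (ℕ → Tm) → Set
    BeforeRenaming σ τ υ = Σ (ℕ → ℕ) λ ρ → σ ≗ var ∘ ρ × renTm ρ ∘ τ ≗ υ

    beforeRenaming-var : ∀ {σ τ υ} → BeforeRenaming σ τ υ → subTm σ ∘ τ ≗ υ
    beforeRenaming-var {τ = τ} (ρ , σ≗ρ , ρτ≗υ) n = trans (sym (renTm-as-subTm σ≗ρ (τ n))) (ρτ≗υ n)

    beforeRenaming-exts : ∀ {σ τ υ} → BeforeRenaming σ τ υ →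
                          BeforeRenaming (exts σ) (exts τ) (exts υ)
    beforeRenaming-exts {τ = τ} {υ} (ρ , σ≗ρ , ρτ≗υ) = ext ρ , exts-var σ≗ρ , λ where
      zero    → refl
      (suc n) → begin
        renTm (ext ρ) (renTm suc (τ n))  ≡⟨ renTm-renTm (λ _ → refl) (τ n) ⟩
        renTm (suc ∘ ρ) (τ n)            ≡⟨ sym (renTm-renTm (λ _ → refl) (τ n)) ⟩
        renTm suc (renTm ρ (τ n))        ≡⟨ cong (renTm suc) (ρτ≗υ n) ⟩
        renTm suc (υ n)                  ∎

    open Fusion BeforeRenaming beforeRenaming-var beforeRenaming-exts

  subTy-subTy : ∀ {σ τ υ} → subTm σ ∘ τ ≗ υ → ∀ φ → subTy σ (subTy τ φ) ≡ subTy υ φ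
  subTy-subTy = subTy-fusion
    where
    Composes : (ℕ → Tm) → (ℕ → Tm) → (ℕ → Tm) → Set
    Composes σ τ υ = subTm σ ∘ τ ≗ υ

    composes-exts : ∀ {σ τ υ} → Composes σ τ υ → Composes (exts σ) (exts τ) (exts υ)
    composes-exts h zero    = refl
    composes-exts {σ} {τ} {υ} h (suc n) = begin
      subTm (exts σ) (renTm suc (τ n))  ≡⟨ subTm-renTm (exts σ) suc (τ n) ⟩
      subTm (renTm suc ∘ σ) (τ n)       ≡⟨ sym (renTm-subTm suc σ (τ n)) ⟩
      renTm suc (subTm σ (τ n))         ≡⟨ cong (renTm suc) (h n) ⟩
      renTm suc (υ n)                   ∎

    open Fusion Composes id composes-exts

  subTm-single-renTm-suc : ∀ u t → subTm (single u) (renTm suc t) ≡ t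
  subTm-single-renTm-suc u t = trans (subTm-renTm (single u) suc t) (subTm-id (λ _ → refl) t)

  subTy-[]Ty : ∀ σ φ t → subTy σ (φ [ t ]Ty) ≡ subTy (exts σ) φ [ subTm σ t ]Ty
  subTy-[]Ty σ φ t = trans (subTy-subTy (λ _ → refl) φ) (sym (subTy-subTy single-exts φ))
    where
    single-exts : subTm (single (subTm σ t)) ∘ exts σ ≗ subTm σ ∘ single t
    single-exts zero    = refl
    single-exts (suc n) = subTm-single-renTm-suc (subTm σ t) (σ n)

  infixr 5 _•_

  _•_ : Tm → (ℕ → Tm) → ℕ → Tm
  (t • σ) zero    = t
  (t • σ) (suc n) = σ n

  exts-[]Ty : ∀ σ φ t → subTy (exts σ) φ [ t ]Ty ≡ subTy (t • σ) φ
  exts-[]Ty σ φ t = subTy-subTy single-exts φ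
    where
    single-exts : subTm (single t) ∘ exts σ ≗ t • σ
    single-exts zero    = refl
    single-exts (suc n) = subTm-single-renTm-suc t (σ n)

  mutual
    subTm-↦t : ∀ σ {t t₁} → t ↦t t₁ → subTm σ t ↦t subTm σ t₁
    subTm-↦t σ (ocApp-c r)   = ocApp-c (subTm-↦t σ r)
    subTm-↦t σ (ocAppNu-c r) = ocAppNu-c (subTm-↦t σ r)
    subTm-↦t σ (lam₁ r)      = lam₁ (subTy-↦ σ r)
    subTm-↦t σ (lam₂ r)      = lam₂ (subTm-↦t (exts σ) r)
    subTm-↦t σ (app₁ r)      = app₁ (subTm-↦t σ r)
    subTm-↦t σ (app₂ r)      = app₂ (subTm-↦t σ r)
    subTm-↦t σ (choice₁ r)   = choice₁ (subTm-↦t σ r)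
    subTm-↦t σ (choice₂ r)   = choice₂ (subTm-↦t σ r)
    subTm-↦t σ (nuApp-c r)   = nuApp-c (subTm-↦t σ r)
    subTm-↦t σ (pair₁ r)     = pair₁ (subTm-↦t σ r)
    subTm-↦t σ (pair₂ r)     = pair₂ (subTm-↦t σ r)
    subTm-↦t σ (proj-c r)    = proj-c (subTm-↦t σ r)
    subTm-↦t σ (case₁ r)     = case₁ (subTm-↦t σ r)
    subTm-↦t σ (case₂ r)     = case₂ (subTm-↦t σ r)

    subTy-↦ : ∀ σ {φ φ₁} → φ ↦ φ₁ → subTy σ φ ↦ subTy σ φ₁
    subTy-↦ σ (β {A} {φ} {t}) =
      subst (subTy σ (tapp (tlam A φ) t) ↦_) (sym (subTy-[]Ty σ φ t)) β
    subTy-↦ σ (tlam₁ r)    = tlam₁ (subTy-↦ σ r)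
    subTy-↦ σ (tlam₂ r)    = tlam₂ (subTy-↦ (exts σ) r)
    subTy-↦ σ (tapp₁ r)    = tapp₁ (subTy-↦ σ r)
    subTy-↦ σ (tapp₂ r)    = tapp₂ (subTm-↦t σ r)
    subTy-↦ σ (tall₁ r)    = tall₁ (subTy-↦ σ r)
    subTy-↦ σ (tall₂ r)    = tall₂ (subTy-↦ (exts σ) r)
    subTy-↦ σ (toplus-c r) = toplus-c (subTy-↦ σ r)
    subTy-↦ σ (tsigma-c r) = tsigma-c (subTy-↦ σ r)
    subTy-↦ σ (tand₁ r)    = tand₁ (subTy-↦ σ r)
    subTy-↦ σ (tand₂ r)    = tand₂ (subTy-↦ σ r)

  renTm-↦t : ∀ ρ {t t₁} → t ↦t t₁ → renTm ρ t ↦t renTm ρ t₁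
  renTm-↦t ρ {t} {t₁} r =
    subst₂ _↦t_ (sym (renTm-as-subTm (λ _ → refl) t)) (sym (renTm-as-subTm (λ _ → refl) t₁))
           (subTm-↦t (var ∘ ρ) r)

module StrongNormalisation (O N Pr K : Set) where
  open System O N Pr K
  open Substitution O N Pr K

  sn : Ty → Set
  sn = Acc (flip _↦_)

  snTm : Tm → Set
  snTm = Acc (flip _↦t_)

  sn-tlam : ∀ {A φ} → sn A → sn φ → sn (tlam A φ)
  sn-tlam = acc-cong₂ tlam λ where
    (tlam₁ r) → inj₁ (_ , r , refl)
    (tlam₂ r) → inj₂ (_ , r , refl)

  sn-tall : ∀ {A B} → sn A → sn B → sn (tall A B)
  sn-tall = acc-cong₂ tall λ where
    (tall₁ r) → inj₁ (_ , r , refl)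
    (tall₂ r) → inj₂ (_ , r , refl)

  sn-tand : ∀ {A B} → sn A → sn B → sn (tand A B)
  sn-tand = acc-cong₂ tand λ where
    (tand₁ r) → inj₁ (_ , r , refl)
    (tand₂ r) → inj₂ (_ , r , refl)

  sn-toplus : ∀ {A} → sn A → sn (toplus A)
  sn-toplus = acc-cong toplus λ { (toplus-c r) → _ , r , refl }

  sn-tsigma : ∀ {A} → sn A → sn (tsigma A)
  sn-tsigma = acc-cong tsigma λ { (tsigma-c r) → _ , r , refl }

  snTm-ocApp : ∀ {o t} → snTm t → snTm (ocApp o t)
  snTm-ocApp = acc-cong (ocApp _) λ { (ocApp-c r) → _ , r , refl }

  snTm-ocAppNu : ∀ {o t ν} → snTm t → snTm (ocAppNu o t ν)
  snTm-ocAppNu = acc-cong (λ t → ocAppNu _ t _) λ { (ocAppNu-c r) → _ , r , refl }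

  snTm-nuApp : ∀ {t ν} → snTm t → snTm (nuApp t ν)
  snTm-nuApp = acc-cong (λ t → nuApp t _) λ { (nuApp-c r) → _ , r , refl }

  snTm-proj : ∀ {t j} → snTm t → snTm (proj t j)
  snTm-proj = acc-cong (λ t → proj t _) λ { (proj-c r) → _ , r , refl }

  snTm-lam : ∀ {A t} → sn A → snTm t → snTm (lam A t)
  snTm-lam = acc-cong₂ lam λ where
    (lam₁ r) → inj₁ (_ , r , refl)
    (lam₂ r) → inj₂ (_ , r , refl)

  snTm-app : ∀ {t s} → snTm t → snTm s → snTm (app t s)
  snTm-app = acc-cong₂ app λ where
    (app₁ r) → inj₁ (_ , r , refl)
    (app₂ r) → inj₂ (_ , r , refl)

  snTm-choice : ∀ {t p s} → snTm t → snTm s → snTm (choice t p s)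
  snTm-choice = acc-cong₂ (λ t s → choice t _ s) λ where
    (choice₁ r) → inj₁ (_ , r , refl)
    (choice₂ r) → inj₂ (_ , r , refl)

  snTm-pair : ∀ {t s} → snTm t → snTm s → snTm (pair t s)
  snTm-pair = acc-cong₂ pair λ where
    (pair₁ r) → inj₁ (_ , r , refl)
    (pair₂ r) → inj₂ (_ , r , refl)

  snTm-case : ∀ {t κs s} → snTm t → snTm s → snTm (case t κs s)
  snTm-case = acc-cong₂ (λ t s → case t _ s) λ where
    (case₁ r) → inj₁ (_ , r , refl)
    (case₂ r) → inj₂ (_ , r , refl)

  -- Substitutions are weakened when they pass under a binder, so the terms substituted
  -- must stay strongly normalising under renaming.
  SnRen : Tm → Set
  SnRen t = ∀ ρ → snTm (renTm ρ t)

  snRen⇒snTm : ∀ {t} → SnRen t → snTm t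
  snRen⇒snTm {t} h = subst snTm (renTm-id t) (h id)

  snRen-↦t : ∀ {t t₁} → t ↦t t₁ → SnRen t → SnRen t₁
  snRen-↦t r h ρ = acc-inverse (h ρ) (renTm-↦t ρ r)

  snRen-var : ∀ n → SnRen (var n)
  snRen-var n ρ = acc λ ()

  snRen-renTm : ∀ ρ {t} → SnRen t → SnRen (renTm ρ t)
  snRen-renTm ρ {t} h ρ₁ = subst snTm (sym (renTm-renTm (λ _ → refl) t)) (h (ρ₁ ∘ ρ))

  Reducible : ℕ → Ty → Set
  Reducible zero    φ = sn φ
  Reducible (suc n) φ = sn φ × (∀ t → SnRen t → Reducible n (tapp φ t))

  reducible⇒sn : ∀ n {φ} → Reducible n φ → sn φ
  reducible⇒sn zero    h = h
  reducible⇒sn (suc n) h = proj₁ h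

  reducible-↦ : ∀ n {φ φ₁} → φ ↦ φ₁ → Reducible n φ → Reducible n φ₁
  reducible-↦ zero    r h       = acc-inverse h r
  reducible-↦ (suc n) r (h , f) = acc-inverse h r , λ t rt → reducible-↦ n (tapp₁ r) (f t rt)

  Neutral : Ty → Set
  Neutral (tlam _ _) = ⊥
  Neutral _          = ⊤

  mutual
    reducible-neutral : ∀ n {φ} → Neutral φ → (∀ {φ₁} → φ ↦ φ₁ → Reducible n φ₁) → Reducible n φ
    reducible-neutral zero    nφ h = acc h
    reducible-neutral (suc n) nφ h =
      acc (reducible⇒sn (suc n) ∘ h) , λ t rt → reducible-neutral-app n nφ h (snRen⇒snTm rt) rt

    reducible-neutral-app : ∀ n {φ t} → Neutral φ → (∀ {φ₁} → φ ↦ φ₁ → Reducible (suc n) φ₁) →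
                            snTm t → SnRen t → Reducible n (tapp φ t)
    reducible-neutral-app n nφ h st rt =
      reducible-neutral n tt (reducible-neutral-app-↦ n nφ h st rt)

    reducible-neutral-app-↦ : ∀ n {φ t ψ} → Neutral φ →
                              (∀ {φ₁} → φ ↦ φ₁ → Reducible (suc n) φ₁) →
                              snTm t → SnRen t → tapp φ t ↦ ψ → Reducible n ψ
    reducible-neutral-app-↦ n () h st rt β
    reducible-neutral-app-↦ n nφ h st rt (tapp₁ r) = proj₂ (h r) _ rt
    reducible-neutral-app-↦ n nφ h (acc st) rt (tapp₂ r) =
      reducible-neutral-app n nφ h (st r) (snRen-↦t r rt)

  Rigid : Ty → Set
  Rigid (tlam _ _) = ⊥
  Rigid (tapp _ _) = ⊥
  Rigid _          = ⊤

  rigid⇒neutral : ∀ {φ} → Rigid φ → Neutral φ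
  rigid⇒neutral {tvar _}   _ = tt
  rigid⇒neutral {tall _ _} _ = tt
  rigid⇒neutral {toplus _} _ = tt
  rigid⇒neutral {tsigma _} _ = tt
  rigid⇒neutral {tand _ _} _ = tt

  rigid-↦ : ∀ {φ φ₁} → Rigid φ → φ ↦ φ₁ → Rigid φ₁
  rigid-↦ _ (tall₁ _)    = tt
  rigid-↦ _ (tall₂ _)    = tt
  rigid-↦ _ (toplus-c _) = tt
  rigid-↦ _ (tsigma-c _) = tt
  rigid-↦ _ (tand₁ _)    = tt
  rigid-↦ _ (tand₂ _)    = tt

  reducible-rigid : ∀ n {φ} → Rigid φ → sn φ → Reducible n φ
  reducible-rigid n rφ (acc h) =
    reducible-neutral n (rigid⇒neutral rφ) λ r → reducible-rigid n (rigid-↦ rφ r) (h r)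

  ReducibleBody : ℕ → Ty → Set
  ReducibleBody n φ = ∀ u → SnRen u → Reducible n (φ [ u ]Ty)

  reducibleBody-↦ : ∀ n {φ φ₁} → φ ↦ φ₁ → ReducibleBody n φ → ReducibleBody n φ₁
  reducibleBody-↦ n r h u ru = reducible-↦ n (subTy-↦ (single u) r) (h u ru)

  mutual
    reducible-β : ∀ n {A φ t} → sn A → sn φ → snTm t → SnRen t → ReducibleBody n φ →
                  Reducible n (tapp (tlam A φ) t)
    reducible-β n sA sφ st rt h = reducible-neutral n tt (reducible-β-↦ n sA sφ st rt h)

    reducible-β-↦ : ∀ n {A φ t ψ} → sn A → sn φ → snTm t → SnRen t → ReducibleBody n φ →
                    tapp (tlam A φ) t ↦ ψ → Reducible n ψ
    reducible-β-↦ n sA sφ st rt h β = h _ rt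
    reducible-β-↦ n (acc sA) sφ st rt h (tapp₁ (tlam₁ r)) = reducible-β n (sA r) sφ st rt h
    reducible-β-↦ n sA (acc sφ) st rt h (tapp₁ (tlam₂ r)) =
      reducible-β n sA (sφ r) st rt (reducibleBody-↦ n r h)
    reducible-β-↦ n sA sφ (acc st) rt h (tapp₂ r) = reducible-β n sA sφ (st r) (snRen-↦t r rt) h

  reducible-tlam : ∀ n {A φ} → sn A → sn φ → (∀ m → ReducibleBody m φ) → Reducible n (tlam A φ)
  reducible-tlam zero    sA sφ h = sn-tlam sA sφ
  reducible-tlam (suc n) sA sφ h =
    sn-tlam sA sφ , λ t rt → reducible-β n sA sφ (snRen⇒snTm rt) rt (h n)

  SnRenSub : (ℕ → Tm) → Set
  SnRenSub σ = ∀ n → SnRen (σ n)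

  snRenSub-exts : ∀ {σ} → SnRenSub σ → SnRenSub (exts σ)
  snRenSub-exts g zero    = snRen-var zero
  snRenSub-exts g (suc n) = snRen-renTm suc (g n)

  snRenSub-• : ∀ {t σ} → SnRen t → SnRenSub σ → SnRenSub (t • σ)
  snRenSub-• rt g zero    = rt
  snRenSub-• rt g (suc n) = g n

  mutual
    snTm-subTm : ∀ t σ → SnRenSub σ → snTm (subTm σ t)
    snTm-subTm (var n)         σ g = snRen⇒snTm (g n)
    snTm-subTm (oc o)          σ g = acc λ ()
    snTm-subTm (ocApp o t)     σ g = snTm-ocApp (snTm-subTm t σ g)
    snTm-subTm (ocNu o ν)      σ g = acc λ ()
    snTm-subTm (ocAppNu o t ν) σ g = snTm-ocAppNu (snTm-subTm t σ g)
    snTm-subTm (lam A t)       σ g =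
      snTm-lam (sn-subTy A σ g) (snTm-subTm t (exts σ) (snRenSub-exts g))
    snTm-subTm (app t s)       σ g = snTm-app (snTm-subTm t σ g) (snTm-subTm s σ g)
    snTm-subTm (choice t p s)  σ g = snTm-choice (snTm-subTm t σ g) (snTm-subTm s σ g)
    snTm-subTm (nuApp t ν)     σ g = snTm-nuApp (snTm-subTm t σ g)
    snTm-subTm (pair t s)      σ g = snTm-pair (snTm-subTm t σ g) (snTm-subTm s σ g)
    snTm-subTm (proj t j)      σ g = snTm-proj (snTm-subTm t σ g)
    snTm-subTm (box κ)         σ g = acc λ ()
    snTm-subTm (case t κs s)   σ g = snTm-case (snTm-subTm t σ g) (snTm-subTm s σ g)

    snRen-subTm : ∀ t σ → SnRenSub σ → SnRen (subTm σ t)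
    snRen-subTm t σ g ρ =
      subst snTm (sym (renTm-subTm ρ σ t)) (snTm-subTm t (renTm ρ ∘ σ) (snRen-renTm ρ ∘ g))

    sn-subTy : ∀ φ σ → SnRenSub σ → sn (subTy σ φ)
    sn-subTy φ σ g = reducible⇒sn zero (reducible-subTy φ σ g zero)

    reducible-subTy : ∀ φ σ → SnRenSub σ → ∀ n → Reducible n (subTy σ φ)
    reducible-subTy (tvar α)   σ g n = reducible-rigid n tt (acc λ ())
    reducible-subTy (tlam A φ) σ g n =
      reducible-tlam n (sn-subTy A σ g) (sn-subTy φ (exts σ) (snRenSub-exts g)) λ m u ru →
        subst (Reducible m) (sym (exts-[]Ty σ φ u)) (reducible-subTy φ (u • σ) (snRenSub-• ru g) m)
    reducible-subTy (tapp φ t) σ g n =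
      proj₂ (reducible-subTy φ σ g (suc n)) (subTm σ t) (snRen-subTm t σ g)
    reducible-subTy (tall A B) σ g n =
      reducible-rigid n tt (sn-tall (sn-subTy A σ g) (sn-subTy B (exts σ) (snRenSub-exts g)))
    reducible-subTy (toplus A) σ g n = reducible-rigid n tt (sn-toplus (sn-subTy A σ g))
    reducible-subTy (tsigma A) σ g n = reducible-rigid n tt (sn-tsigma (sn-subTy A σ g))
    reducible-subTy (tand A B) σ g n =
      reducible-rigid n tt (sn-tand (sn-subTy A σ g) (sn-subTy B σ g))

  ↦-stronglyNormalizing : StronglyNormalizing _↦_
  ↦-stronglyNormalizing φ = subst sn (subTy-id (λ _ → refl) φ) (sn-subTy φ var snRen-var)

  InfiniteReductionFrom : Ty → Set
  InfiniteReductionFrom φ = ∃[ f ] InfiniteDescendingSequenceFrom (flip _↦_) f φ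

  sn⇒SN : ∀ {φ} → sn φ → SN φ
  sn⇒SN = descent∧acc⇒unsatisfiable {P = InfiniteReductionFrom} λ where
    (f , refl , f↦) → f 1 , f↦ 0 , f ∘ suc , refl , f↦ ∘ suc

module Reducibles
  (O N Pr K : Set)
  (_⊢t_∶_ : System.Ctx O N Pr K → System.Tm O N Pr K → System.Ty O N Pr K → Set)
  where

  open System O N Pr K
  open Typing _⊢t_∶_
  open StrongNormalisation O N Pr K using (↦-stronglyNormalizing; sn⇒SN)

  depth-subK : ∀ σ Ψ → depth (subK σ Ψ) ≡ depth Ψ
  depth-subK σ ⋆       = refl
  depth-subK σ (Π A Ψ) = cong suc (depth-subK (exts σ) Ψ)

  kinded⇒RedAt : ∀ n {Γ Ψ φ} → depth Ψ ≡ n → Γ ⊢ φ ∶ Ψ → RedAt n Γ Ψ φ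
  kinded⇒RedAt zero    {Ψ = ⋆}     {φ} _  ⊢φ = ⊢φ , sn⇒SN (↦-stronglyNormalizing φ)
  kinded⇒RedAt (suc n) {Ψ = Π B Ψ}     d  ⊢φ =
    ⊢φ , λ s ⊢s → kinded⇒RedAt n (trans (depth-subK (single s) Ψ) (suc-injective d)) (app ⊢φ ⊢s)

mainTheorem10 : (O N Pr K : Set) →
    let open System O N Pr K in
    (_⊢t_∶_ : Ctx → Tm → Ty → Set) →
    let open Typing _⊢t_∶_ in
    (Γ : Ctx) (Φ : Kind) (φ : Ty) → Γ ⊢K Φ → Γ ⊢ φ ∶ Φ → Red Γ Φ φ
mainTheorem10 O N Pr K _⊢t_∶_ Γ Φ φ _ ⊢φ = Reducibles.kinded⇒RedAt O N Pr K _⊢t_∶_ _ refl ⊢φ
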